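{- If $G$ and $H$ are graphs which both admit nontrivial path covers, then the outcome of the Maker-Breaker domination game on $G \square H$ is $\mathcal{D}$, i.e., Dominator has a winning strategy both in the D-game and in the S-game on $G \square H$.
   Context: A path cover of a graph $G$ is a set of pairwise vertex-disjoint paths (subgraphs of $G$) covering $V(G)$; it is nontrivial if every path in it has at least one edge. The Maker-Breaker domination game on a finite graph $G$ is played by Dominator and Staller, who alternately claim a previously unplayed vertex of $G$ until all vertices are played. Dominator wins if his claimed vertices form a dominating set of $G$; otherwise Staller wins (equivalently, Staller claims all vertices of some closed neighborhood $N_G[v]$). The D-game is the game where Dominator moves first, the S-game where Staller moves first. The outcome is $\mathcal{D}$ if Dominator has a winning strategy in both the D-game and the S-game. $G\square H$ is the Cartesian product: vertex set $V(G)\times V(H)$, $(g,h)\sim(g',h')$ iff either $gg'\in E(G)$ and $h=h'$, or $g=g'$ and $hh'\in E(H)$. -}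

module Defs where

open import Data.Nat using (ℕ; _*_; _≥_)
open import Data.Fin using (Fin; remQuot; _≟_)
open import Data.Product using (Σ; ∃; _×_; _,_; proj₁; proj₂)
open import Data.Sum using (_⊎_)
open import Data.List using (List; []; _∷_; length; concat)
open import Data.List.Membership.Propositional using (_∈_)
open import Data.List.Relation.Unary.Unique.Propositional using (Unique)
open import Data.List.Relation.Unary.All using (All)
open import Relation.Binary.PropositionalEquality using (_≡_; _≢_)
open import Relation.Nullary using (¬_; yes; no)

record Graph : Set₁ where
  field
    n      : ℕ
    Adj    : Fin n → Fin n → Set
    sym    : ∀ {u v} → Adj u v → Adj v u
    irrefl : ∀ {v} → ¬ Adj v v
open Graph public

-- Cartesian product G □ H; vertex (g , h) is encoded as combine g h : Fin (n G * n H).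
CartAdj : (G H : Graph) → Fin (n G * n H) → Fin (n G * n H) → Set
CartAdj G H x y =
  let (g , h)   = remQuot {n G} (n H) x
      (g' , h') = remQuot {n G} (n H) y
  in (Adj G g g' × h ≡ h') ⊎ (g ≡ g' × Adj H h h')

_□_ : Graph → Graph → Graph
G □ H = record
  { n      = n G * n H
  ; Adj    = CartAdj G H
  ; sym    = symP
  ; irrefl = irr
  }
  where
  open import Data.Sum using (inj₁; inj₂)
  open import Relation.Binary.PropositionalEquality renaming (sym to ≡sym) using ()
  symP : ∀ {x y} → CartAdj G H x y → CartAdj G H y x
  symP (inj₁ (a , e)) = inj₁ (Graph.sym G a , ≡sym e)
  symP (inj₂ (e , a)) = inj₂ (≡sym e , Graph.sym H a)
  irr : ∀ {x} → ¬ CartAdj G H x x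
  irr (inj₁ (a , _)) = Graph.irrefl G a
  irr (inj₂ (_ , a)) = Graph.irrefl H a

Walk : (G : Graph) → List (Fin (n G)) → Set
Walk G []           = Data.Unit.⊤ where import Data.Unit
Walk G (u ∷ [])     = Data.Unit.⊤ where import Data.Unit
Walk G (u ∷ v ∷ vs) = Adj G u v × Walk G (v ∷ vs)

NontrivialPath : (G : Graph) → List (Fin (n G)) → Set
NontrivialPath G p = length p ≥ 2 × Walk G p × Unique p

-- a nontrivial path cover: pairwise vertex-disjoint nontrivial paths covering V(G)
-- (disjointness + distinctness inside each path = concatenation has no repeats)
NontrivialPathCover : (G : Graph) → List (List (Fin (n G))) → Set
NontrivialPathCover G ps =
  All (NontrivialPath G) ps × Unique (concat ps) × (∀ v → v ∈ concat ps)

HasNontrivialPathCover : Graph → Set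
HasNontrivialPathCover G = ∃ λ ps → NontrivialPathCover G ps

data Owner : Set where
  free dom stal : Owner

data Player : Set where
  Dominator Staller : Player

Position : Graph → Set
Position G = Fin (n G) → Owner

empty : (G : Graph) → Position G
empty G _ = free

claim : (G : Graph) → Position G → Fin (n G) → Owner → Position G
claim G p v o u with u ≟ v
... | yes _ = o
... | no  _ = p u

Dominates : (G : Graph) → Position G → Set
Dominates G p = ∀ v → ∃ λ u → p u ≡ dom × (u ≡ v ⊎ Adj G u v)

data DomWins (G : Graph) : Position G → Player → Set where
  finished : ∀ {p t} → (∀ v → p v ≢ free) → Dominates G p → DomWins G p t
  domMove  : ∀ {p} v → p v ≡ free → DomWins G (claim G p v dom) Staller →
             DomWins G p Dominator
  stalMove : ∀ {p} → (∃ λ v → p v ≡ free) →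
             (∀ v → p v ≡ free → DomWins G (claim G p v stal) Dominator) →
             DomWins G p Staller

OutcomeD : Graph → Set
OutcomeD G = DomWins G (empty G) Dominator × DomWins G (empty G) Staller

-- Cut every path of the two covers into paths on two or three vertices.  The products of
-- these pieces partition the vertices of G □ H into copies of P₂ □ P₂, P₂ □ P₃, P₃ □ P₂ and
-- P₃ □ P₃, and Dominator answers each Staller move inside the piece where it was made.  The
-- first three pieces have a perfect matching, so Dominator just takes the mate of Staller's
-- vertex.  On the 3 × 3 grid he answers Staller's first move there by a fixed reply and then
-- takes the partner in a pairing of the remaining vertices.  Every vertex is dominated inside
-- its own piece, and spare moves never hurt Dominator, so he wins the D-game and the S-game.

module Submission where

open import Algebra.Definitions using (Involutive)
open import Data.Bool using (if_then_else_)
open import Data.Empty using (⊥; ⊥-elim)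
open import Data.Fin using (Fin; zero; suc; _≟_; toℕ; combine; remQuot; opposite)
open import Data.Fin.Patterns using (0F; 1F; 2F)
open import Data.Fin.Properties
  using (any?; all?; suc-injective; opposite-involutive; remQuot-combine; combine-remQuot; combine-injective)
open import Data.List using (List; []; _∷_; _++_; length; lookup; concat)
open import Data.List.Membership.Propositional using (_∈_)
open import Data.List.Membership.Propositional.Properties using (∈-lookup; ∈-++⁺ʳ; ∈-concat⁺′; ∈-concat⁻)
open import Data.List.Properties using (concat-++)
open import Data.List.Relation.Unary.All as All using (All; []; _∷_)
open import Data.List.Relation.Unary.All.Properties using () renaming (++⁺ to All-++⁺)
open import Data.List.Relation.Unary.AllPairs using ([]; _∷_)
open import Data.List.Relation.Unary.Any as Any using (here; there)
open import Data.List.Relation.Unary.Any.Properties using (lookup-index)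
open import Data.List.Relation.Unary.Unique.Propositional using (Unique)
import Data.Nat as ℕ
open import Data.Nat using (ℕ; zero; suc; _+_; _*_; _≤_; _<_; z≤n; s≤s; ∣_-_∣)
open import Data.Nat.Properties
  using (≤-refl; ≤-trans; <-≤-trans; ≤-pred; <⇒≤; n≮0; m≤n⇒m≤1+n; +-monoʳ-<; ∣-∣-comm; ∣n-n∣≡0; 0≢1+n)
open import Data.Product using (∃; ∃₂; _×_; _,_; proj₁; proj₂; uncurry)
open import Data.Product.Properties using (≡-dec)
open import Data.Sum as Sum using (_⊎_; inj₁; inj₂)
open import Data.Unit using (tt)
open import Function using (_∘_; id)
open import Relation.Binary.Definitions using (DecidableEquality)
open import Relation.Binary.PropositionalEquality
  using (_≡_; _≢_; _≗_; refl; sym; trans; cong; cong₂; subst; subst₂; module ≡-Reasoning)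
open import Relation.Nullary using (¬_; Dec; yes; no; does; contradiction; ¬?; _×-dec_; _⊎-dec_)
open import Relation.Nullary.Decidable using (from-yes)

open import Defs hiding (sym)

free? : (o : Owner) → Dec (o ≡ free)
free? free = yes refl
free? dom  = no λ ()
free? stal = no λ ()

[free] : Owner → ℕ
[free] free = 1
[free] dom  = 0
[free] stal = 0

#free : ∀ {m} → (Fin m → Owner) → ℕ
#free {zero}  p = 0
#free {suc m} p = [free] (p zero) + #free (p ∘ suc)

#free-cong : ∀ {m} {p q : Fin m → Owner} → p ≗ q → #free p ≡ #free q
#free-cong {zero}  e = refl
#free-cong {suc m} e = cong₂ _+_ (cong [free] (e zero)) (#free-cong (e ∘ suc))

#free≤ : ∀ {m} (p : Fin m → Owner) → #free p ≤ m
#free≤ {zero}  p = z≤n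
#free≤ {suc m} p with p zero
... | free = s≤s (#free≤ (p ∘ suc))
... | dom  = m≤n⇒m≤1+n (#free≤ (p ∘ suc))
... | stal = m≤n⇒m≤1+n (#free≤ (p ∘ suc))

#free-update : ∀ {m} {p q : Fin m → Owner} v → (∀ u → u ≢ v → q u ≡ p u) →
               p v ≡ free → q v ≢ free → #free q < #free p
#free-update {p = p} {q} zero same pv qv
  rewrite pv | #free-cong {p = q ∘ suc} {p ∘ suc} (λ u → same (suc u) λ ()) with q zero
... | free = contradiction refl qv
... | dom  = ≤-refl
... | stal = ≤-refl
#free-update {p = p} {q} (suc v) same pv qv rewrite same zero (λ ()) =
  +-monoʳ-< ([free] (p zero)) (#free-update v (λ u u≢v → same (suc u) (u≢v ∘ suc-injective)) pv qv)

module _ (G : Graph) where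

  claim-self : ∀ p v o → claim G p v o v ≡ o
  claim-self p v o with v ≟ v
  ... | yes _    = refl
  ... | no v≢v = contradiction refl v≢v

  claim-other : ∀ p {v} o {u} → u ≢ v → claim G p v o u ≡ p u
  claim-other p {v} o {u} u≢v with u ≟ v
  ... | yes u≡v = contradiction u≡v u≢v
  ... | no _    = refl

  claim-kept : ∀ p o {v u o′} → p v ≡ free → p u ≡ o′ → o′ ≢ free → claim G p v o u ≡ o′
  claim-kept p o pv pu o′≢free =
    trans (claim-other p o λ u≡v → o′≢free (trans (sym pu) (trans (cong p u≡v) pv))) pu

  claim-cong : ∀ {p q} → p ≗ q → ∀ v o → claim G p v o ≗ claim G q v o
  claim-cong p≗q v o u with u ≟ v
  ... | yes _ = refl
  ... | no _  = p≗q u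

  #free-claim : ∀ {p v o} → p v ≡ free → o ≢ free → #free (claim G p v o) < #free p
  #free-claim {p} {v} {o} pv o≢free =
    #free-update v (λ u → claim-other p o) pv (λ e → o≢free (trans (sym (claim-self p v o)) e))

N[_] : (G : Graph) → Fin (n G) → Fin (n G) → Set
N[ G ] v u = u ≡ v ⊎ Adj G u v

Reply : (G : Graph) → (Position G → Set) → Position G → Set
Reply G Safe p = Safe p ⊎ ∃ λ y → p y ≡ free × Safe (claim G p y dom)

-- Safe-cong is needed because positions are functions: a claim in G, restricted to a part,
-- agrees with the same claim made in the part only pointwise.
record DomStrategy (G : Graph) : Set₁ where
  field
    Safe       : Position G → Set
    Safe-cong  : ∀ {p q} → p ≗ q → Safe p → Safe q
    Safe-empty : Safe (empty G)
    Safe-dom   : ∀ {p v} → Safe p → p v ≡ free → Safe (claim G p v dom)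
    Safe-reply : ∀ {p v} → Safe p → p v ≡ free → Reply G Safe (claim G p v stal)
    Safe-full  : ∀ {p} → Safe p → (∀ v → p v ≢ free) → Dominates G p

module _ {G : Graph} (S : DomStrategy G) where
  open DomStrategy S

  private
    claim-within : ∀ {k p v o} → #free p ≤ k → p v ≡ free → o ≢ free → #free (claim G p v o) ≤ k
    claim-within bound pv o≢free = ≤-trans (<⇒≤ (#free-claim G pv o≢free)) bound

    claim-below : ∀ {k p v o} → #free p ≤ suc k → p v ≡ free → o ≢ free → #free (claim G p v o) ≤ k
    claim-below bound pv o≢free = ≤-pred (≤-trans (#free-claim G pv o≢free) bound)

    finish : ∀ {p t} → Safe p → ¬ (∃ λ v → p v ≡ free) → DomWins G p t
    finish safe none = finished full (Safe-full safe full)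
      where full = λ v pv → none (v , pv)

  mutual
    dominatorToMove : ∀ {k} p → #free p ≤ k → Safe p → DomWins G p Dominator
    dominatorToMove p bound safe with any? (free? ∘ p)
    ... | no none       = finish safe none
    ... | yes (y , py) = domMove y py (stallerToMove _ (claim-within bound py λ ()) (Safe-dom safe py))

    stallerToMove : ∀ {k} p → #free p ≤ k → Safe p → DomWins G p Staller
    stallerToMove p bound safe with any? (free? ∘ p)
    ... | no none  = finish safe none
    ... | yes some = stalMove some (afterStaller p bound safe)

    afterStaller : ∀ {k} p → #free p ≤ k → Safe p → ∀ v → p v ≡ free →
                   DomWins G (claim G p v stal) Dominator
    afterStaller {zero} p bound safe v pv =
      contradiction (<-≤-trans (#free-claim G {o = stal} pv λ ()) bound) n≮0
    afterStaller {suc k} p bound safe v pv with Safe-reply safe pv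
    ... | inj₁ safe′            = dominatorToMove _ (claim-below bound pv λ ()) safe′
    ... | inj₂ (y , py , safe′) =
          domMove y py (stallerToMove _ (claim-within (claim-below bound pv λ ()) py λ ()) safe′)

  DomStrategy⇒OutcomeD : OutcomeD G
  DomStrategy⇒OutcomeD = dominatorToMove _ (#free≤ (empty G)) Safe-empty
                       , stallerToMove _ (#free≤ (empty G)) Safe-empty

record Embedding (B G : Graph) : Set where
  field
    to           : Fin (n B) → Fin (n G)
    to-injective : ∀ {a b} → to a ≡ to b → a ≡ b
    to-adj       : ∀ {a b} → Adj B a b → Adj G (to a) (to b)

  to-N : ∀ {v u} → N[ B ] v u → N[ G ] (to v) (to u)
  to-N (inj₁ u≡v) = inj₁ (cong to u≡v)
  to-N (inj₂ uv)  = inj₂ (to-adj uv)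

  claim-to : ∀ p a o u → claim G p (to a) o (to u) ≡ claim B (p ∘ to) a o u
  claim-to p a o u with u ≟ a
  ... | yes refl = claim-self G p (to a) o
  ... | no u≢a   = claim-other G p o (u≢a ∘ to-injective)

open Embedding

record Decomposition (G : Graph) : Set₁ where
  field
    Index    : Set
    _≟ᵢ_     : DecidableEquality Index
    part     : Index → Graph
    embed    : ∀ i → Embedding (part i) G
    disjoint : ∀ {i j a b} → to (embed i) a ≡ to (embed j) b → i ≡ j
    covers   : ∀ v → ∃₂ λ i a → to (embed i) a ≡ v

module _ {G : Graph} (D : Decomposition G) (strategy : ∀ i → DomStrategy (Decomposition.part D i)) where
  open Decomposition D
  module S i = DomStrategy (strategy i)

  private
    restrict : ∀ i → Position G → Position (part i)
    restrict i p = p ∘ to (embed i)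

    Safe : Position G → Set
    Safe p = ∀ i → S.Safe i (restrict i p)

    SafeExcept : Index → Position G → Set
    SafeExcept i p = ∀ j → j ≢ i → S.Safe j (restrict j p)

    restrict-claim-outside : ∀ {i j} p a o → j ≢ i → restrict j (claim G p (to (embed i) a) o) ≗ restrict j p
    restrict-claim-outside p a o j≢i u = claim-other G p o (j≢i ∘ disjoint)

    except-claim : ∀ {i p} a o → SafeExcept i p → SafeExcept i (claim G p (to (embed i) a) o)
    except-claim a o safe j j≢i = S.Safe-cong j (sym ∘ restrict-claim-outside _ a o j≢i) (safe j j≢i)

    safe-claim : ∀ {i p} a o → SafeExcept i p → S.Safe i (claim (part i) (restrict i p) a o) →
                 Safe (claim G p (to (embed i) a) o)
    safe-claim {i} a o safe safeᵢ j with j ≟ᵢ i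
    ... | yes refl = S.Safe-cong i (sym ∘ claim-to (embed i) _ a o) safeᵢ
    ... | no j≢i   = except-claim a o safe j j≢i

    reply : ∀ {p v} → Safe p → p v ≡ free → Reply G Safe (claim G p v stal)
    reply {p} {v} safe pv with covers v
    ... | i , a , refl with S.Safe-reply i (safe i) pv
    ...   | inj₁ safeᵢ = inj₁ (safe-claim a stal (λ j _ → safe j) safeᵢ)
    ...   | inj₂ (y , py , safeᵢ) =
            inj₂ (to (embed i) y , trans (claim-to (embed i) p a stal y) py ,
                  safe-claim y dom (except-claim a stal λ j _ → safe j)
                    (S.Safe-cong i (claim-cong (part i) (sym ∘ claim-to (embed i) p a stal) y dom) safeᵢ))

    full : ∀ {p} → Safe p → (∀ v → p v ≢ free) → Dominates G p
    full safe noFree v with covers v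
    ... | i , a , refl with S.Safe-full i (safe i) (noFree ∘ to (embed i)) a
    ...   | u , pu , near = to (embed i) u , pu , to-N (embed i) near

  decomposition-strategy : DomStrategy G
  decomposition-strategy = record
    { Safe       = Safe
    ; Safe-cong  = λ p≗q safe i → S.Safe-cong i (p≗q ∘ to (embed i)) (safe i)
    ; Safe-empty = λ i → S.Safe-empty i
    ; Safe-dom   = λ {p} {v} safe pv → dom-move safe pv (covers v)
    ; Safe-reply = reply
    ; Safe-full  = full
    }
    where
    dom-move : ∀ {p v} → Safe p → p v ≡ free → (∃₂ λ i a → to (embed i) a ≡ v) → Safe (claim G p v dom)
    dom-move safe pv (i , a , refl) = safe-claim a dom (λ j _ → safe j) (S.Safe-dom i (safe i) pv)

module _ (G : Graph) where
  private
    V = Fin (n G)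

  PairedBy : (V → V) → Position G → Set
  PairedBy m p = ∀ u → m u ≢ u → p u ≡ stal → p (m u) ≡ dom

  PairCovers : (V → V) → V → Set
  PairCovers m v = ∃ λ u → m u ≢ u × N[ G ] v u × N[ G ] v (m u)

  module _ {m : V → V} where

    paired-cong : ∀ {p q} → p ≗ q → PairedBy m p → PairedBy m q
    paired-cong p≗q paired u mu≢u qu = trans (sym (p≗q (m u))) (paired u mu≢u (trans (p≗q u) qu))

    paired-dom : ∀ {p v} → PairedBy m p → p v ≡ free → PairedBy m (claim G p v dom)
    paired-dom {p} {v} paired pv u mu≢u pu with u ≟ v
    ... | yes refl = contradiction pu λ ()
    ... | no _     = claim-kept G p dom pv (paired u mu≢u pu) λ ()

    paired-stal : ∀ {p v} → PairedBy m p → p v ≡ free → m v ≡ v ⊎ p (m v) ≡ dom →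
                  PairedBy m (claim G p v stal)
    paired-stal {p} {v} paired pv answered u mu≢u pu with u ≟ v | answered
    ... | yes refl | inj₁ mu≡u = contradiction mu≡u mu≢u
    ... | yes refl | inj₂ pmu  = claim-kept G p stal pv pmu λ ()
    ... | no _     | _         = claim-kept G p stal pv (paired u mu≢u pu) λ ()

    paired-answer : ∀ {p v} → PairedBy m p → p v ≡ free → m v ≢ v → p (m v) ≡ free →
                    PairedBy m (claim G (claim G p v stal) (m v) dom)
    paired-answer {p} {v} paired pv mv≢v pmv u mu≢u pu with u ≟ m v
    ... | yes refl = contradiction pu λ ()
    ... | no u≢mv with u ≟ v
    ...   | yes refl = claim-self G _ (m u) dom
    ...   | no _     = claim-kept G (claim G p v stal) dom {m v} {m u} (trans (claim-other G p stal mv≢v) pmv)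
                         (claim-kept G p stal pv (paired u mu≢u pu) λ ()) λ ()

    paired-reply : ∀ {p v} → Involutive _≡_ m → PairedBy m p → p v ≡ free →
                   Reply G (PairedBy m) (claim G p v stal)
    paired-reply {p} {v} inv paired pv with m v ≟ v
    ... | yes mv≡v = inj₁ (paired-stal paired pv (inj₁ mv≡v))
    ... | no mv≢v with p (m v) in pmv
    ...   | free = inj₂ (m v , trans (claim-other G p stal mv≢v) pmv , paired-answer paired pv mv≢v pmv)
    ...   | dom  = inj₁ (paired-stal paired pv (inj₂ pmv))
    ...   | stal = contradiction (trans (sym pv) pv-dom) λ ()
      where
      pv-dom : p v ≡ dom
      pv-dom = subst (λ w → p w ≡ dom) (inv v) (paired (m v) (λ e → mv≢v (trans (sym e) (inv v))) pmv)

    paired-full : ∀ {p v} → PairedBy m p → (∀ u → p u ≢ free) → PairCovers m v →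
                  ∃ λ u → p u ≡ dom × N[ G ] v u
    paired-full {p} paired noFree (u , mu≢u , near-u , near-mu) with p u in pu
    ... | free = contradiction pu (noFree u)
    ... | dom  = u , pu , near-u
    ... | stal = m u , paired u mu≢u pu , near-mu

  pairing-strategy : (m : V → V) → Involutive _≡_ m → (∀ v → PairCovers m v) → DomStrategy G
  pairing-strategy m inv covers = record
    { Safe       = PairedBy m
    ; Safe-cong  = paired-cong
    ; Safe-empty = λ _ _ ()
    ; Safe-dom   = paired-dom
    ; Safe-reply = paired-reply inv
    ; Safe-full  = λ paired noFree v → paired-full paired noFree (covers v)
    }

record PerfectMatching (G : Graph) : Set where
  field
    mate            : Fin (n G) → Fin (n G)
    mate-involutive : Involutive _≡_ mate
    mate-adj        : ∀ v → Adj G (mate v) v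

perfectMatching-strategy : ∀ {G} → PerfectMatching G → DomStrategy G
perfectMatching-strategy {G} M = pairing-strategy G mate mate-involutive λ v →
  v , (λ mv≡v → irrefl G (subst (λ w → Adj G w v) mv≡v (mate-adj v))) , inj₁ refl , inj₂ (mate-adj v)
  where open PerfectMatching M

-- Dominator answers Staller's first move x by reply x and from then on plays the pairing
-- partner x, which leaves x unpaired.
record TriggeredPairing (G : Graph) : Set where
  field
    reply              : Fin (n G) → Fin (n G)
    partner            : Fin (n G) → Fin (n G) → Fin (n G)
    reply-moves        : ∀ x → reply x ≢ x
    partner-fixes      : ∀ x → partner x x ≡ x
    partner-involutive : ∀ x → Involutive _≡_ (partner x)
    covers             : ∀ x v → N[ G ] v (reply x) ⊎ PairCovers G (partner x) v

triggeredPairing-strategy : ∀ {G} → TriggeredPairing G → DomStrategy G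
triggeredPairing-strategy {G} T = record
  { Safe       = Safe
  ; Safe-cong  = safe-cong
  ; Safe-empty = inj₁ λ _ ()
  ; Safe-dom   = safe-dom
  ; Safe-reply = safe-reply
  ; Safe-full  = safe-full
  }
  where
  open TriggeredPairing T

  Untouched : Position G → Set
  Untouched p = ∀ u → p u ≢ stal

  Marked : Fin (n G) → Position G → Set
  Marked x p = p x ≡ stal × p (reply x) ≡ dom

  Safe : Position G → Set
  Safe p = Untouched p ⊎ ∃ λ x → Marked x p × PairedBy G (partner x) p

  safe-cong : ∀ {p q} → p ≗ q → Safe p → Safe q
  safe-cong p≗q (inj₁ untouched) = inj₁ λ u qu → untouched u (trans (p≗q u) qu)
  safe-cong p≗q (inj₂ (x , (px , py) , paired)) =
    inj₂ (x , (trans (sym (p≗q x)) px , trans (sym (p≗q (reply x))) py) , paired-cong G p≗q paired)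

  marked-claim : ∀ {p v x} o → p v ≡ free → Marked x p → Marked x (claim G p v o)
  marked-claim {p} o pv (px , py) = claim-kept G p o pv px (λ ()) , claim-kept G p o pv py (λ ())

  claim-dom-stal : ∀ p y {u} → claim G p y dom u ≡ stal → p u ≡ stal
  claim-dom-stal p y {u} qu with u ≟ y
  ... | yes _ = contradiction qu λ ()
  ... | no _  = qu

  first-stal : ∀ {p v} → Untouched p → ∀ u → claim G p v stal u ≡ stal → u ≡ v
  first-stal {p} {v} untouched u qu with u ≟ v
  ... | yes u≡v = u≡v
  ... | no _    = contradiction qu (untouched u)

  first-safe : ∀ {p v q} → Untouched p → (∀ u → q u ≡ stal → claim G p v stal u ≡ stal) → Marked v q → Safe q
  first-safe {p} {v} untouched only marked = inj₂ (v , marked , paired)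
    where
    paired : PairedBy G (partner v) _
    paired u mu≢u qu with first-stal {p} untouched u (only u qu)
    ... | refl = contradiction (partner-fixes v) mu≢u

  safe-dom : ∀ {p v} → Safe p → p v ≡ free → Safe (claim G p v dom)
  safe-dom {p} {v} (inj₁ untouched) pv = inj₁ λ u qu → untouched u (claim-dom-stal p v qu)
  safe-dom (inj₂ (x , marked , paired)) pv = inj₂ (x , marked-claim dom pv marked , paired-dom G paired pv)

  safe-reply : ∀ {p v} → Safe p → p v ≡ free → Reply G Safe (claim G p v stal)
  safe-reply {p} {v} (inj₁ untouched) pv with p (reply v) in py
  ... | stal = contradiction py (untouched (reply v))
  ... | dom  = inj₁ (first-safe untouched (λ _ qu → qu) (claim-self G p v stal , claim-kept G p stal pv py λ ()))
  ... | free = inj₂ (reply v , qy , first-safe untouched (λ u → claim-dom-stal q (reply v) {u})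
                                      (claim-kept G q dom {reply v} {v} qy (claim-self G p v stal) (λ ()) ,
                                       claim-self G q (reply v) dom))
    where
    q = claim G p v stal
    qy : q (reply v) ≡ free
    qy = trans (claim-other G p stal (reply-moves v)) py
  safe-reply (inj₂ (x , marked , paired)) pv with paired-reply G (partner-involutive x) paired pv
  ... | inj₁ paired′ = inj₁ (inj₂ (x , marked-claim stal pv marked , paired′))
  ... | inj₂ (y , py , paired′) =
        inj₂ (y , py , inj₂ (x , marked-claim dom py (marked-claim stal pv marked) , paired′))

  safe-full : ∀ {p} → Safe p → (∀ v → p v ≢ free) → Dominates G p
  safe-full {p} (inj₁ untouched) noFree v with p v in pv
  ... | free = contradiction pv (noFree v)
  ... | dom  = v , pv , inj₁ refl
  ... | stal = contradiction pv (untouched v)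
  safe-full (inj₂ (x , (_ , py) , paired)) noFree v with covers x v
  ... | inj₁ near   = reply x , py , near
  ... | inj₂ covers = paired-full G paired noFree covers

module _ {G H : Graph} where

  private
    Cart : Fin (n G) × Fin (n H) → Fin (n G) × Fin (n H) → Set
    Cart (a , b) (a′ , b′) = (Adj G a a′ × b ≡ b′) ⊎ (a ≡ a′ × Adj H b b′)

  □-adj : ∀ {a a′ b b′} → Cart (a , b) (a′ , b′) → Adj (G □ H) (combine a b) (combine a′ b′)
  □-adj {a} {a′} {b} {b′} =
    subst₂ Cart (sym (remQuot-combine {n G} {n H} a b)) (sym (remQuot-combine {n G} {n H} a′ b′))

  □-elim : ∀ {P : Fin (n G * n H) → Set} → (∀ a b → P (combine {n G} {n H} a b)) → ∀ x → P x
  □-elim {P} h x = subst P (combine-remQuot {n G} (n H) x) (uncurry h (remQuot {n G} (n H) x))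

  □-adj⁻ : ∀ {a a′ b b′} → Adj (G □ H) (combine a b) (combine a′ b′) → Cart (a , b) (a′ , b′)
  □-adj⁻ {a} {a′} {b} {b′} =
    subst₂ Cart (remQuot-combine {n G} {n H} a b) (remQuot-combine {n G} {n H} a′ b′)

module _ {B C G H : Graph} where

  □-map : (Fin (n B) → Fin (n G)) → (Fin (n C) → Fin (n H)) → Fin (n (B □ C)) → Fin (n (G □ H))
  □-map f g x = uncurry (λ a b → combine (f a) (g b)) (remQuot {n B} (n C) x)

  □-map-combine : ∀ f g a b → □-map f g (combine a b) ≡ combine (f a) (g b)
  □-map-combine f g a b = cong (uncurry λ a b → combine (f a) (g b)) (remQuot-combine {n B} {n C} a b)

  □-embedding : Embedding B G → Embedding C H → Embedding (B □ C) (G □ H)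
  □-embedding e f = record
    { to           = □-map (to e) (to f)
    ; to-injective = injective _ _
    ; to-adj       = adjacent _ _
    }
    where
    combine-to = □-map-combine (to e) (to f)

    injective : ∀ x y → □-map (to e) (to f) x ≡ □-map (to e) (to f) y → x ≡ y
    injective = □-elim {B} {C} λ a b → □-elim {B} {C} λ a′ b′ eq →
      let (ea , fb) = combine-injective (to e a) (to f b) (to e a′) (to f b′)
                        (trans (sym (combine-to a b)) (trans eq (combine-to a′ b′)))
      in cong₂ combine (to-injective e ea) (to-injective f fb)

    lift : ∀ {a a′ b b′} → (Adj B a a′ × b ≡ b′) ⊎ (a ≡ a′ × Adj C b b′) →
           (Adj G (to e a) (to e a′) × to f b ≡ to f b′) ⊎ (to e a ≡ to e a′ × Adj H (to f b) (to f b′))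
    lift (inj₁ (aa′ , b≡b′)) = inj₁ (to-adj e aa′ , cong (to f) b≡b′)
    lift (inj₂ (a≡a′ , bb′)) = inj₂ (cong (to e) a≡a′ , to-adj f bb′)

    adjacent : ∀ x y → Adj (B □ C) x y → Adj (G □ H) (□-map (to e) (to f) x) (□-map (to e) (to f) y)
    adjacent = □-elim {B} {C} λ a b → □-elim {B} {C} λ a′ b′ xy →
      subst₂ (Adj (G □ H)) (sym (combine-to a b)) (sym (combine-to a′ b′))
        (□-adj {G} {H} (lift (□-adj⁻ {B} {C} xy)))

  □-embedding-combine : ∀ e f a b → to (□-embedding e f) (combine a b) ≡ combine (to e a) (to f b)
  □-embedding-combine e f = □-map-combine (to e) (to f)

□-decomposition : ∀ {G H} → Decomposition G → Decomposition H → Decomposition (G □ H)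
□-decomposition {G} {H} D E = record
  { Index    = D.Index × E.Index
  ; _≟ᵢ_     = ≡-dec D._≟ᵢ_ E._≟ᵢ_
  ; part     = λ (i , j) → D.part i □ E.part j
  ; embed    = embed
  ; disjoint = λ {ij} {ij′} {x} {y} → disjoint ij ij′ x y
  ; covers   = □-elim {G} {H} covers
  }
  where
  module D = Decomposition D
  module E = Decomposition E

  embed : ∀ ((i , j) : D.Index × E.Index) → Embedding (D.part i □ E.part j) (G □ H)
  embed (i , j) = □-embedding (D.embed i) (E.embed j)

  disjoint : ∀ ij ij′ x y → to (embed ij) x ≡ to (embed ij′) y → ij ≡ ij′
  disjoint (i , j) (i′ , j′) =
    □-elim {D.part i} {E.part j} λ a b → □-elim {D.part i′} {E.part j′} λ a′ b′ eq →
      let (ea , eb) = combine-injective _ _ _ _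
                        (trans (sym (□-embedding-combine (D.embed i) (E.embed j) a b))
                          (trans eq (□-embedding-combine (D.embed i′) (E.embed j′) a′ b′)))
      in cong₂ _,_ (D.disjoint ea) (E.disjoint eb)

  covers : ∀ g h → ∃₂ λ ij x → to (embed ij) x ≡ combine g h
  covers g h with D.covers g | E.covers h
  ... | i , a , refl | j , b , refl = (i , j) , combine a b , □-embedding-combine (D.embed i) (E.embed j) a b

module _ {G H : Graph} where

  private
    □-matching : ∀ (f : Fin (n G) → Fin (n G)) (g : Fin (n H) → Fin (n H)) →
                 Involutive _≡_ f → Involutive _≡_ g →
                 (∀ a b → Adj (G □ H) (combine (f a) (g b)) (combine a b)) → PerfectMatching (G □ H)
    □-matching f g f-inv g-inv adj = record
      { mate            = m
      ; mate-involutive = □-elim {G} {H} λ a b → begin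
          m (m (combine a b))         ≡⟨ cong m (m-combine a b) ⟩
          m (combine (f a) (g b))     ≡⟨ m-combine (f a) (g b) ⟩
          combine (f (f a)) (g (g b)) ≡⟨ cong₂ combine (f-inv a) (g-inv b) ⟩
          combine a b                 ∎
      ; mate-adj        = □-elim {G} {H} λ a b →
          subst (λ x → Adj (G □ H) x (combine a b)) (sym (m-combine a b)) (adj a b)
      }
      where
      open ≡-Reasoning
      m = □-map {G} {H} {G} {H} f g
      m-combine = □-map-combine {G} {H} {G} {H} f g

  □-perfectMatchingˡ : PerfectMatching G → PerfectMatching (G □ H)
  □-perfectMatchingˡ M = □-matching mate id mate-involutive (λ _ → refl)
                           λ a b → □-adj {G} {H} (inj₁ (mate-adj a , refl))
    where open PerfectMatching M

  □-perfectMatchingʳ : PerfectMatching H → PerfectMatching (G □ H)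
  □-perfectMatchingʳ M = □-matching id mate (λ _ → refl) mate-involutive
                           λ a b → □-adj {G} {H} (inj₂ (refl , mate-adj b))
    where open PerfectMatching M

lookup-injective : ∀ {A : Set} {xs : List A} → Unique xs → ∀ {i j} → lookup xs i ≡ lookup xs j → i ≡ j
lookup-injective (_ ∷ _)     {zero}  {zero}  _ = refl
lookup-injective (x∉xs ∷ _)  {zero}  {suc j} e = contradiction e (All.lookup x∉xs (∈-lookup j))
lookup-injective (x∉xs ∷ _)  {suc i} {zero}  e = contradiction (sym e) (All.lookup x∉xs (∈-lookup i))
lookup-injective (_ ∷ uniq)  {suc i} {suc j} e = cong suc (lookup-injective uniq e)

++-disjoint : ∀ {A : Set} xs {ys : List A} {v} → Unique (xs ++ ys) → v ∈ xs → v ∈ ys → ⊥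
++-disjoint (x ∷ xs) (x∉ ∷ _)   (here refl)  v∈ys = All.lookup x∉ (∈-++⁺ʳ xs v∈ys) refl
++-disjoint (x ∷ xs) (_ ∷ uniq) (there v∈xs) v∈ys = ++-disjoint xs uniq v∈xs v∈ys

++-uniqueʳ : ∀ {A : Set} xs {ys : List A} → Unique (xs ++ ys) → Unique ys
++-uniqueʳ []       uniq       = uniq
++-uniqueʳ (x ∷ xs) (_ ∷ uniq) = ++-uniqueʳ xs uniq

concat-unique-index : ∀ {A : Set} (xss : List (List A)) → Unique (concat xss) →
                      ∀ {v i j} → v ∈ lookup xss i → v ∈ lookup xss j → i ≡ j
concat-unique-index (xs ∷ xss) uniq {i = zero}  {zero}  _  _  = refl
concat-unique-index (xs ∷ xss) uniq {i = zero}  {suc j} vi vj =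
  ⊥-elim (++-disjoint xs uniq vi (∈-concat⁺′ vj (∈-lookup {xs = xss} j)))
concat-unique-index (xs ∷ xss) uniq {i = suc i} {zero}  vi vj =
  ⊥-elim (++-disjoint xs uniq vj (∈-concat⁺′ vi (∈-lookup {xs = xss} i)))
concat-unique-index (xs ∷ xss) uniq {i = suc i} {suc j} vi vj =
  cong suc (concat-unique-index xss (++-uniqueʳ xs uniq) vi vj)

Path : ℕ → Graph
Path k = record
  { n      = k
  ; Adj    = λ a b → ∣ toℕ a - toℕ b ∣ ≡ 1
  ; sym    = λ {a} {b} d → trans (∣-∣-comm (toℕ b) (toℕ a)) d
  ; irrefl = λ {a} d → 0≢1+n (trans (sym (∣n-n∣≡0 (toℕ a))) d)
  }

Path₂-perfectMatching : PerfectMatching (Path 2)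
Path₂-perfectMatching = record
  { mate            = opposite
  ; mate-involutive = opposite-involutive
  ; mate-adj        = λ { zero → refl ; (suc zero) → refl }
  }

walk-adj : ∀ G vs → Walk G vs → ∀ {a b} → Adj (Path (length vs)) a b → Adj G (lookup vs a) (lookup vs b)
walk-adj G (x ∷ y ∷ vs) (xy , _) {zero}     {suc zero} _ = xy
walk-adj G (x ∷ y ∷ vs) (xy , _) {suc zero} {zero}     _ = Graph.sym G xy
walk-adj G (x ∷ y ∷ vs) (_ , w)  {suc a}    {suc b}    d = walk-adj G (y ∷ vs) w {a} {b} d
walk-adj G (x ∷ [])     _        {zero}     {zero}     ()
walk-adj G (x ∷ y ∷ vs) _        {zero}     {zero}     ()
walk-adj G (x ∷ y ∷ vs) _        {zero}     {suc (suc b)} ()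
walk-adj G (x ∷ y ∷ vs) _        {suc (suc a)} {zero}  ()

path-embedding : ∀ {G vs} → NontrivialPath G vs → Embedding (Path (length vs)) G
path-embedding {G} {vs} (_ , walk , uniq) = record
  { to           = lookup vs
  ; to-injective = lookup-injective uniq
  ; to-adj       = walk-adj G vs walk
  }

Short : ∀ {A : Set} → List A → Set
Short q = length q ≡ 2 ⊎ length q ≡ 3

split-short : ∀ {G} p → NontrivialPath G p → ∃ λ qs → concat qs ≡ p × All (λ q → NontrivialPath G q × Short q) qs
split-short (x ∷ [])             (s≤s () , _)
split-short (x ∷ y ∷ [])         path = (x ∷ y ∷ []) ∷ [] , refl , (path , inj₁ refl) ∷ []
split-short (x ∷ y ∷ z ∷ [])     path = (x ∷ y ∷ z ∷ []) ∷ [] , refl , (path , inj₂ refl) ∷ []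
split-short (x ∷ y ∷ z ∷ w ∷ vs) (_ , (xy , walk) , x∉ ∷ _ ∷ uniq)
  with split-short (z ∷ w ∷ vs) (s≤s (s≤s z≤n) , proj₂ walk , uniq)
... | qs , eq , shorts =
      (x ∷ y ∷ []) ∷ qs , cong (λ r → x ∷ y ∷ r) eq ,
      ((s≤s (s≤s z≤n) , (xy , tt) , (All.head x∉ ∷ []) ∷ [] ∷ []) , inj₁ refl) ∷ shorts

split-shorts : ∀ {G ps} → All (NontrivialPath G) ps →
               ∃ λ qs → concat qs ≡ concat ps × All (λ q → NontrivialPath G q × Short q) qs
split-shorts [] = [] , refl , []
split-shorts {ps = p ∷ ps} (path ∷ paths) with split-short p path | split-shorts paths
... | qs , eq , shorts | qs′ , eq′ , shorts′ =
      qs ++ qs′ , trans (sym (concat-++ qs qs′)) (cong₂ _++_ eq eq′) , All-++⁺ shorts shorts′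

shortPathCover : ∀ {G} → HasNontrivialPathCover G → ∃ λ qs → NontrivialPathCover G qs × All Short qs
shortPathCover (ps , paths , uniq , cover) with split-shorts paths
... | qs , eq , shorts =
      qs , (All.map proj₁ shorts , subst Unique (sym eq) uniq , λ v → subst (v ∈_) (sym eq) (cover v)) ,
      All.map proj₂ shorts

pathCover-decomposition : ∀ {G ps} → NontrivialPathCover G ps → Decomposition G
pathCover-decomposition {G} {ps} (paths , uniq , cover) = record
  { Index    = Fin (length ps)
  ; _≟ᵢ_     = _≟_
  ; part     = λ i → Path (length (lookup ps i))
  ; embed    = λ i → path-embedding (All.lookup paths (∈-lookup i))
  ; disjoint = λ {i} {j} {a} {b} e →
      concat-unique-index ps uniq (∈-lookup a) (subst (_∈ lookup ps j) (sym e) (∈-lookup b))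
  ; covers   = λ v → let v∈ = ∈-concat⁻ ps (cover v) in
      Any.index v∈ , Any.index (lookup-index v∈) , sym (lookup-index (lookup-index v∈))
  }

IsShortPath : Graph → Set₁
IsShortPath B = B ≡ Path 2 ⊎ B ≡ Path 3

pathCover-short : ∀ {G ps} (cover : NontrivialPathCover G ps) → All Short ps →
                  ∀ i → IsShortPath (Decomposition.part (pathCover-decomposition cover) i)
pathCover-short cover shorts i = Sum.map (cong Path) (cong Path) (All.lookup shorts (∈-lookup i))

AdjDecidable : Graph → Set
AdjDecidable G = ∀ u v → Dec (Adj G u v)

Path-adj? : ∀ k → AdjDecidable (Path k)
Path-adj? k a b = ∣ toℕ a - toℕ b ∣ ℕ.≟ 1

□-adj? : ∀ {G H} → AdjDecidable G → AdjDecidable H → AdjDecidable (G □ H)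
□-adj? {G} {H} adjG? adjH? x y =
  let (a , b) = remQuot {n G} (n H) x ; (a′ , b′) = remQuot {n G} (n H) y
  in (adjG? a a′ ×-dec b ≟ b′) ⊎-dec (a ≟ a′ ×-dec adjH? b b′)

module _ {G : Graph} (adj? : AdjDecidable G) where

  N? : ∀ v u → Dec (N[ G ] v u)
  N? v u = u ≟ v ⊎-dec adj? u v

  PairCovers? : ∀ m v → Dec (PairCovers G m v)
  PairCovers? m v = any? λ u → ¬? (m u ≟ u) ×-dec N? v u ×-dec N? v (m u)

swapping : ∀ {k} → List (Fin k × Fin k) → Fin k → Fin k
swapping []             u = u
swapping ((a , b) ∷ ps) u = if does (u ≟ a) then b else if does (u ≟ b) then a else swapping ps u

Grid : Graph
Grid = Path 3 □ Path 3

⟨_,_⟩ : Fin 3 → Fin 3 → Fin (n Grid)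
⟨ r , c ⟩ = combine r c

-- The plans for ⟨ 0F , 0F ⟩, ⟨ 0F , 1F ⟩ and ⟨ 1F , 1F ⟩ were found by search; the others are
-- their images under the symmetries of the grid.
gridPlan : Fin 3 → Fin 3 → Fin (n Grid) × List (Fin (n Grid) × Fin (n Grid))
gridPlan 0F 0F = ⟨ 0F , 1F ⟩ , (⟨ 1F , 0F ⟩ , ⟨ 1F , 1F ⟩) ∷ (⟨ 1F , 2F ⟩ , ⟨ 2F , 2F ⟩) ∷ (⟨ 2F , 0F ⟩ , ⟨ 2F , 1F ⟩) ∷ []
gridPlan 0F 1F = ⟨ 1F , 0F ⟩ , (⟨ 0F , 0F ⟩ , ⟨ 1F , 1F ⟩) ∷ (⟨ 0F , 2F ⟩ , ⟨ 1F , 2F ⟩) ∷ (⟨ 2F , 1F ⟩ , ⟨ 2F , 2F ⟩) ∷ []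
gridPlan 0F 2F = ⟨ 0F , 1F ⟩ , (⟨ 1F , 0F ⟩ , ⟨ 2F , 0F ⟩) ∷ (⟨ 1F , 1F ⟩ , ⟨ 1F , 2F ⟩) ∷ (⟨ 2F , 1F ⟩ , ⟨ 2F , 2F ⟩) ∷ []
gridPlan 1F 0F = ⟨ 0F , 1F ⟩ , (⟨ 0F , 0F ⟩ , ⟨ 1F , 1F ⟩) ∷ (⟨ 1F , 2F ⟩ , ⟨ 2F , 2F ⟩) ∷ (⟨ 2F , 0F ⟩ , ⟨ 2F , 1F ⟩) ∷ []
gridPlan 1F 1F = ⟨ 0F , 1F ⟩ , (⟨ 0F , 0F ⟩ , ⟨ 1F , 0F ⟩) ∷ (⟨ 1F , 2F ⟩ , ⟨ 2F , 2F ⟩) ∷ (⟨ 2F , 0F ⟩ , ⟨ 2F , 1F ⟩) ∷ []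
gridPlan 1F 2F = ⟨ 0F , 1F ⟩ , (⟨ 0F , 2F ⟩ , ⟨ 1F , 1F ⟩) ∷ (⟨ 1F , 0F ⟩ , ⟨ 2F , 0F ⟩) ∷ (⟨ 2F , 1F ⟩ , ⟨ 2F , 2F ⟩) ∷ []
gridPlan 2F 0F = ⟨ 2F , 1F ⟩ , (⟨ 0F , 0F ⟩ , ⟨ 0F , 1F ⟩) ∷ (⟨ 0F , 2F ⟩ , ⟨ 1F , 2F ⟩) ∷ (⟨ 1F , 0F ⟩ , ⟨ 1F , 1F ⟩) ∷ []
gridPlan 2F 1F = ⟨ 1F , 0F ⟩ , (⟨ 0F , 1F ⟩ , ⟨ 0F , 2F ⟩) ∷ (⟨ 1F , 1F ⟩ , ⟨ 2F , 0F ⟩) ∷ (⟨ 1F , 2F ⟩ , ⟨ 2F , 2F ⟩) ∷ []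
gridPlan 2F 2F = ⟨ 2F , 1F ⟩ , (⟨ 0F , 0F ⟩ , ⟨ 1F , 0F ⟩) ∷ (⟨ 0F , 1F ⟩ , ⟨ 0F , 2F ⟩) ∷ (⟨ 1F , 1F ⟩ , ⟨ 1F , 2F ⟩) ∷ []

grid-triggeredPairing : TriggeredPairing Grid
grid-triggeredPairing = record
  { reply              = reply
  ; partner            = partner
  ; reply-moves        = from-yes (all? λ x → ¬? (reply x ≟ x))
  ; partner-fixes      = from-yes (all? λ x → partner x x ≟ x)
  ; partner-involutive = from-yes (all? λ x → all? λ u → partner x (partner x u) ≟ u)
  ; covers             = from-yes (all? λ x → all? λ v →
                           N? {Grid} adj? v (reply x) ⊎-dec PairCovers? {Grid} adj? (partner x) v)
  }
  where
  adj? : AdjDecidable Grid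
  adj? = □-adj? {Path 3} {Path 3} (Path-adj? 3) (Path-adj? 3)
  plan : Fin (n Grid) → Fin (n Grid) × List (Fin (n Grid) × Fin (n Grid))
  plan x = uncurry gridPlan (remQuot 3 x)
  reply : Fin (n Grid) → Fin (n Grid)
  reply = proj₁ ∘ plan
  partner : Fin (n Grid) → Fin (n Grid) → Fin (n Grid)
  partner = swapping ∘ proj₂ ∘ plan

shortPath□-strategy : ∀ {B C} → IsShortPath B → IsShortPath C → DomStrategy (B □ C)
shortPath□-strategy (inj₁ refl) _           = perfectMatching-strategy (□-perfectMatchingˡ Path₂-perfectMatching)
shortPath□-strategy (inj₂ refl) (inj₁ refl) = perfectMatching-strategy (□-perfectMatchingʳ Path₂-perfectMatching)
shortPath□-strategy (inj₂ refl) (inj₂ refl) = triggeredPairing-strategy grid-triggeredPairing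

theorem3p2 : (G H : Graph) → HasNontrivialPathCover G → HasNontrivialPathCover H →
    OutcomeD (G □ H)
theorem3p2 G H hasCoverG hasCoverH with shortPathCover hasCoverG | shortPathCover hasCoverH
... | _ , coverG , shortG | _ , coverH , shortH =
  DomStrategy⇒OutcomeD (decomposition-strategy
    (□-decomposition (pathCover-decomposition coverG) (pathCover-decomposition coverH))
    λ (i , j) → shortPath□-strategy (pathCover-short coverG shortG i) (pathCover-short coverH shortH j))
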